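{- Let $d \ge 2$ be an integer and let $p(t) = \frac{1}{d+1}\Bigl((d-1) - \sum_{i=1}^{d} 2t^i\Bigr)$. Then the circulant matrix $V_{p(t)}$ is nonsingular and has (multiplicative) order $d+1$ if $d$ is odd, and order $2(d+1)$ if $d$ is even.
   Context: For $p(t) = a_0 + a_1 t + \dots + a_d t^d$, the circulant matrix $V_{p(t)}$ is the $(d+1)\times(d+1)$ matrix whose $0$-th row is $\nu = (a_d, a_{d-1},\dots,a_1,a_0)$ and whose $i$-th row ($i=0,\dots,d$) is $T^i\nu$, where $T(a_d,a_{d-1},\dots,a_1,a_0) = (a_0,a_d,\dots,a_1)$ is the cyclic shift. The order of a nonsingular matrix $V$ is the least positive integer $n$ with $V^n = I$. -}

module Defs where

open import Data.Nat as ℕ using (ℕ; zero; suc; _∸_; _<_)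
open import Data.Integer using (+_; -[1+_])
open import Data.Rational using (ℚ; _/_; 0ℚ; 1ℚ; _+_; _*_)
open import Data.Fin using (Fin; zero; suc; fromℕ; inject₁; opposite)
open import Data.Product using (Σ; _×_)
open import Relation.Binary.PropositionalEquality using (_≡_)
open import Relation.Nullary using (¬_)

Mat : ℕ → Set
Mat n = Fin n → Fin n → ℚ

∑ : ∀ {n} → (Fin n → ℚ) → ℚ
∑ {zero}  f = 0ℚ
∑ {suc n} f = f zero + ∑ (λ i → f (suc i))

_⊗_ : ∀ {n} → Mat n → Mat n → Mat n
(A ⊗ B) i j = ∑ (λ k → A i k * B k j)

Id : ∀ {n} → Mat n
Id zero    zero    = 1ℚ
Id zero    (suc j) = 0ℚ
Id (suc i) zero    = 0ℚ
Id (suc i) (suc j) = Id i j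

_^_ : ∀ {n} → Mat n → ℕ → Mat n
A ^ zero  = Id
A ^ suc m = A ⊗ (A ^ m)

_≋_ : ∀ {n} → Mat n → Mat n → Set
A ≋ B = ∀ i j → A i j ≡ B i j

Nonsingular : ∀ {n} → Mat n → Set
Nonsingular {n} A = Σ (Mat n) λ B → (A ⊗ B) ≋ Id × (B ⊗ A) ≋ Id

HasOrder : ∀ {k} → Mat k → ℕ → Set
HasOrder V n = (0 < n) × ((V ^ n) ≋ Id) × (∀ m → 0 < m → m < n → ¬ ((V ^ m) ≋ Id))

T : ∀ {d} → (Fin (suc d) → ℚ) → (Fin (suc d) → ℚ)
T {d} v zero    = v (fromℕ d)
T {d} v (suc j) = v (inject₁ j)

iterT : ∀ {d} → ℕ → (Fin (suc d) → ℚ) → (Fin (suc d) → ℚ)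
iterT zero    v = v
iterT (suc i) v = T (iterT i v)

-- circulant matrix of a polynomial with coefficients a_0..a_d (a k = a_k):
-- row 0 is ν = (a_d, ..., a_0), row i is T^i ν
circulant : ∀ {d} → (Fin (suc d) → ℚ) → Mat (suc d)
circulant a i = iterT (Data.Fin.toℕ i) (λ j → a (opposite j))

pCoeff : (d : ℕ) → Fin (suc d) → ℚ
pCoeff d zero    = (+ (d ∸ 1)) / suc d
pCoeff d (suc i) = -[1+ 1 ] / suc d

-- Put n = d + 1 and c = -2/n. For d ≥ 1 the coefficients of p are δ_{k0} + c,
-- so V = P + cJ, where P is the permutation matrix of the cyclic shift and J
-- is the all-ones matrix. As every P^k has row and column sums 1 and nc = -2,
--   V^k = P^k + c·[k odd]·J,
-- the coefficient of J following γ ↦ c + γ + ncγ = c - γ. The (0,0) entry of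
-- V^m is (P^m)₀₀ + c·[m odd]; since c < 0 it equals 1 exactly when m is even
-- and P^m fixes 0, i.e. n ∣ m, and these two conditions also give V^m = I.
-- So V^m = I iff lcm(2, n) ∣ m: the order is n for odd d and 2n for even d,
-- and V^(2n-1) is the inverse of V.

{-# OPTIONS --safe #-}
module Submission where

open import Defs
open import Data.Nat using (ℕ; _≤_; _*_; suc)
open import Data.Nat.Divisibility using (_∣_)
open import Data.Product using (_×_)
open import Relation.Nullary using (¬_)

open import Level using (0ℓ)
open import Algebra.Bundles using (CommutativeRing)
open import Data.Nat as ℕ using (zero; _+_; _<_; z<s; s<s)
import Data.Nat.Properties as ℕ
open import Data.Nat.Divisibility
  using (divides; divides-refl; ∣-refl; ∣⇒≤; ∣1⇒≡1; ∣m+n∣m⇒∣n; ∣m∣n⇒∣m+n; m%n≡0⇒n∣m;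
         *-pres-∣; n∣m*n; m∣m*n)
open import Data.Nat.DivMod using (_%_; _/_; m≡m%n+[m/n]*n; m%n<n)
open import Data.Nat.GeneralisedArithmetic using (iterate)
open import Data.Nat.Primality using (euclidsLemma; prime[2])
open import Data.Integer as ℤ using (+_; -[1+_])
import Data.Integer.Properties as ℤ
open import Data.Integer.Tactic.RingSolver using (solve-∀; solve)
open import Data.Rational as ℚ using (ℚ; 0ℚ; 1ℚ; -_; toℚᵘ; Negative)
  renaming (_+_ to _+ℚ_; _*_ to _*ℚ_; _-_ to _-ℚ_; _≤_ to _≤ℚ_)
import Data.Rational.Properties as ℚ
open import Data.Rational.Unnormalised as ℚᵘ using (mkℚᵘ; *≡*) renaming (_≃_ to _≃ᵘ_)
import Data.Rational.Unnormalised.Properties as ℚᵘ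
open import Algebra.Properties.Semiring.Sum (CommutativeRing.semiring ℚ.+-*-commutativeRing)
  using (sum; sum-cong-≗; ∑-distrib-+; *-distribˡ-sum; *-distribʳ-sum)
open import Tactic.RingSolver.Core.AlmostCommutativeRing
  using (AlmostCommutativeRing; fromCommutativeRing)
import Tactic.RingSolver as RingSolver
open import Data.Fin using (Fin; zero; suc; fromℕ; inject₁; opposite; toℕ; _≟_)
open import Data.Fin.Properties
  using (toℕ-injective; toℕ-fromℕ; toℕ-inject₁; fromℕ≢inject₁; inject₁-injective;
         opposite-involutive)
open import Data.List using ([]; _∷_)
open import Data.Product using (_,_; proj₁; uncurry)
open import Data.Sum using (_⊎_; inj₁; inj₂; [_,_]′; fromInj₂)
open import Function using (_∘_)
open import Function.Definitions using (Injective)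
open import Relation.Binary.PropositionalEquality
  using (_≡_; _≢_; refl; sym; trans; cong; cong₂; subst; module ≡-Reasoning)
open import Relation.Nullary using (yes; no; contradiction)
open import Relation.Nullary.Decidable using (dec⇒maybe)

ℚ-ring : AlmostCommutativeRing 0ℓ 0ℓ
ℚ-ring = fromCommutativeRing ℚ.+-*-commutativeRing (λ x → dec⇒maybe (0ℚ ℚ.≟ x))

2∣⊎2∣suc : ∀ n → 2 ∣ n ⊎ 2 ∣ suc n
2∣⊎2∣suc zero    = inj₁ (divides 0 refl)
2∣⊎2∣suc (suc n) = [ inj₂ ∘ ∣m∣n⇒∣m+n ∣-refl , inj₁ ]′ (2∣⊎2∣suc n)

¬2∣⇒2∣suc : ∀ {n} → ¬ 2 ∣ n → 2 ∣ suc n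
¬2∣⇒2∣suc {n} ¬2∣n = fromInj₂ (λ 2∣n → contradiction 2∣n ¬2∣n) (2∣⊎2∣suc n)

2∣⇒¬2∣suc : ∀ {n} → 2 ∣ n → ¬ 2 ∣ suc n
2∣⇒¬2∣suc {n} 2∣n 2∣1+n =
  contradiction (∣1⇒≡1 (∣m+n∣m⇒∣n (subst (2 ∣_) (ℕ.+-comm 1 n) 2∣1+n) 2∣n)) λ ()

∣∧2∣⇒2*∣ : ∀ {n m} → ¬ 2 ∣ n → n ∣ m → 2 ∣ m → 2 * n ∣ m
∣∧2∣⇒2*∣ {n} ¬2∣n (divides-refl q) 2∣qn with euclidsLemma q n prime[2] 2∣qn
... | inj₁ (divides-refl r) = *-pres-∣ (n∣m*n r) ∣-refl
... | inj₂ 2∣n              = contradiction 2∣n ¬2∣n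

module _ {A : Set} (f : A → A) where

  iterate-+ : ∀ x m n → iterate f x (m + n) ≡ iterate f (iterate f x m) n
  iterate-+ x zero    n = refl
  iterate-+ x (suc m) n = iterate-+ (f x) m n

  iterate-suc : ∀ x n → iterate f x (suc n) ≡ f (iterate f x n)
  iterate-suc x n = trans (cong (iterate f x) (ℕ.+-comm 1 n)) (iterate-+ x n 1)

  iterate-comm : ∀ x m n → iterate f (iterate f x m) n ≡ iterate f (iterate f x n) m
  iterate-comm x m n = begin
    iterate f (iterate f x m) n ≡⟨ iterate-+ x m n ⟨
    iterate f x (m + n)         ≡⟨ cong (iterate f x) (ℕ.+-comm m n) ⟩
    iterate f x (n + m)         ≡⟨ iterate-+ x n m ⟩
    iterate f (iterate f x n) m ∎
    where open ≡-Reasoning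

  iterate-injective : Injective _≡_ _≡_ f → ∀ k → Injective _≡_ _≡_ (λ x → iterate f x k)
  iterate-injective f-inj zero    eq = eq
  iterate-injective f-inj (suc k) eq = f-inj (iterate-injective f-inj k eq)

  iterate-periodic : ∀ {p} → (∀ x → iterate f x p ≡ x) → ∀ q x → iterate f x (q * p) ≡ x
  iterate-periodic     period zero    x = refl
  iterate-periodic {p} period (suc q) x = begin
    iterate f x (p + q * p)           ≡⟨ iterate-+ x p (q * p) ⟩
    iterate f (iterate f x p) (q * p) ≡⟨ cong (λ y → iterate f y (q * p)) (period x) ⟩
    iterate f x (q * p)               ≡⟨ iterate-periodic period q x ⟩
    x                                 ∎
    where open ≡-Reasoning

-- Rotations of Fin (suc d)

cyclicPred : ∀ {d} → Fin (suc d) → Fin (suc d)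
cyclicPred {d} zero = fromℕ d
cyclicPred (suc j)  = inject₁ j

rotate : ∀ {d} → ℕ → Fin (suc d) → Fin (suc d)
rotate k x = iterate cyclicPred x k

cyclicPred-injective : ∀ {d} → Injective _≡_ _≡_ (cyclicPred {d})
cyclicPred-injective {x = zero}  {zero}  eq = refl
cyclicPred-injective {x = zero}  {suc y} eq = contradiction eq fromℕ≢inject₁
cyclicPred-injective {x = suc x} {zero}  eq = contradiction (sym eq) fromℕ≢inject₁
cyclicPred-injective {x = suc x} {suc y} eq = cong suc (inject₁-injective eq)

rotate-injective : ∀ {d} k → Injective _≡_ _≡_ (rotate {d} k)
rotate-injective = iterate-injective cyclicPred cyclicPred-injective

opposite-injective : ∀ {n} → Injective _≡_ _≡_ (opposite {n})
opposite-injective {x = x} {y} eq =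
  trans (sym (opposite-involutive x)) (trans (cong opposite eq) (opposite-involutive y))

iterT-rotate : ∀ {d} k (v : Fin (suc d) → ℚ) j → iterT k v j ≡ v (rotate k j)
iterT-rotate zero    v j       = refl
iterT-rotate (suc k) v zero    = iterT-rotate k v (cyclicPred zero)
iterT-rotate (suc k) v (suc j) = iterT-rotate k v (cyclicPred (suc j))

toℕ-rotate : ∀ {d} k r (x : Fin (suc d)) → toℕ x ≡ r + k → toℕ (rotate k x) ≡ r
toℕ-rotate zero    r x       eq = trans eq (ℕ.+-identityʳ r)
toℕ-rotate (suc k) r zero    eq = contradiction (trans eq (ℕ.+-suc r k)) ℕ.0≢1+n
toℕ-rotate (suc k) r (suc y) eq =
  toℕ-rotate k r (inject₁ y) (trans (toℕ-inject₁ y) (ℕ.suc-injective (trans eq (ℕ.+-suc r k))))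

rotate-toℕ : ∀ {d} (x : Fin (suc d)) → rotate (toℕ x) x ≡ zero
rotate-toℕ x = toℕ-injective (toℕ-rotate (toℕ x) 0 x refl)

rotate-zero≡zero⇒≡0 : ∀ {d r} → r < suc d → rotate r (zero {d}) ≡ zero → r ≡ 0
rotate-zero≡zero⇒≡0     {r = zero}  _         _  = refl
rotate-zero≡zero⇒≡0 {d} {suc r}     (s<s r<d) eq = contradiction (cong toℕ eq) (ℕ.>⇒≢ (begin-strict
  0                               <⟨ ℕ.m<n⇒0<n∸m r<d ⟩
  d ℕ.∸ r                         ≡⟨ toℕ-rotate r (d ℕ.∸ r) (fromℕ d) d≡[d∸r]+r ⟨
  toℕ (rotate (suc r) (zero {d})) ∎))
  where
  open ℕ.≤-Reasoning
  d≡[d∸r]+r : toℕ (fromℕ d) ≡ d ℕ.∸ r + r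
  d≡[d∸r]+r = trans (toℕ-fromℕ d) (sym (ℕ.m∸n+n≡m (ℕ.<⇒≤ r<d)))

rotate-period : ∀ {d} (x : Fin (suc d)) → rotate (suc d) x ≡ x
rotate-period {d} x = rotate-injective (toℕ x) (begin
  rotate (toℕ x) (rotate (suc d) x) ≡⟨ iterate-comm cyclicPred x (suc d) (toℕ x) ⟩
  rotate (suc d) (rotate (toℕ x) x) ≡⟨ cong (rotate (suc d)) (rotate-toℕ x) ⟩
  rotate (suc d) zero               ≡⟨ toℕ-injective (toℕ-rotate d 0 (fromℕ d) (toℕ-fromℕ d)) ⟩
  zero                              ≡⟨ rotate-toℕ x ⟨
  rotate (toℕ x) x                  ∎)
  where open ≡-Reasoning

rotate-multiple : ∀ {d} q (x : Fin (suc d)) → rotate (q * suc d) x ≡ x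
rotate-multiple = iterate-periodic cyclicPred rotate-period

rotate-rightInverse : ∀ {d} b (x : Fin (suc d)) → rotate b (rotate (b * d) x) ≡ x
rotate-rightInverse {d} b x = begin
  rotate b (rotate (b * d) x) ≡⟨ iterate-+ cyclicPred x (b * d) b ⟨
  rotate (b * d + b) x        ≡⟨ cong (λ k → rotate k x) (trans (ℕ.+-comm (b * d) b) (sym (ℕ.*-suc b d))) ⟩
  rotate (b * suc d) x        ≡⟨ rotate-multiple b x ⟩
  x                           ∎
  where open ≡-Reasoning

rotate-zero≡zero⇒∣ : ∀ {d} m → rotate m (zero {d}) ≡ zero → suc d ∣ m
rotate-zero≡zero⇒∣ {d} m eq = m%n≡0⇒n∣m m n (rotate-zero≡zero⇒≡0 (m%n<n m n) (begin
  rotate r zero                  ≡⟨ rotate-multiple q (rotate r zero) ⟨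
  rotate (q * n) (rotate r zero) ≡⟨ iterate-+ cyclicPred zero r (q * n) ⟨
  rotate (r + q * n) zero        ≡⟨ cong (λ k → rotate k zero) (m≡m%n+[m/n]*n m n) ⟨
  rotate m zero                  ≡⟨ eq ⟩
  zero                           ∎))
  where
  open ≡-Reasoning
  n r q : ℕ
  n = suc d
  r = m % n
  q = m / n

∑≡sum : ∀ {n} (f : Fin n → ℚ) → ∑ f ≡ sum f
∑≡sum {zero}  f = refl
∑≡sum {suc n} f = cong (f zero +ℚ_) (∑≡sum (f ∘ suc))

Id-diag : ∀ {n} (i : Fin n) → Id i i ≡ 1ℚ
Id-diag zero    = refl
Id-diag (suc i) = Id-diag i

Id-offDiag : ∀ {n} {i j : Fin n} → i ≢ j → Id i j ≡ 0ℚ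
Id-offDiag {i = zero}  {zero}  i≢j = contradiction refl i≢j
Id-offDiag {i = zero}  {suc j} i≢j = refl
Id-offDiag {i = suc i} {zero}  i≢j = refl
Id-offDiag {i = suc i} {suc j} i≢j = Id-offDiag (i≢j ∘ cong suc)

Id-sym : ∀ {n} (i j : Fin n) → Id i j ≡ Id j i
Id-sym zero    zero    = refl
Id-sym zero    (suc j) = refl
Id-sym (suc i) zero    = refl
Id-sym (suc i) (suc j) = Id-sym i j

Id≡1⇒≡ : ∀ {n} {i j : Fin n} → Id i j ≡ 1ℚ → i ≡ j
Id≡1⇒≡ {i = zero}  {zero}  eq = refl
Id≡1⇒≡ {i = suc i} {suc j} eq = cong suc (Id≡1⇒≡ eq)

Id≤1 : ∀ {n} (i j : Fin n) → Id i j ≤ℚ 1ℚ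
Id≤1 zero    zero    = ℚ.≤-refl
Id≤1 zero    (suc j) = ℚ.nonNegative⁻¹ 1ℚ
Id≤1 (suc i) zero    = ℚ.nonNegative⁻¹ 1ℚ
Id≤1 (suc i) (suc j) = Id≤1 i j

Id-reindex : ∀ {m n} {f : Fin m → Fin n} → Injective _≡_ _≡_ f → ∀ i j → Id (f i) (f j) ≡ Id i j
Id-reindex {f = f} f-inj i j with i ≟ j
... | yes refl = trans (Id-diag (f i)) (sym (Id-diag i))
... | no  i≢j  = trans (Id-offDiag (i≢j ∘ f-inj)) (sym (Id-offDiag i≢j))

sum-Id-sift : ∀ {n} (i : Fin n) (f : Fin n → ℚ) → sum (λ l → Id i l *ℚ f l) ≡ f i
sum-Id-sift zero    f = begin
  1ℚ *ℚ f zero +ℚ sum (λ l → 0ℚ *ℚ f (suc l))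
    ≡⟨ cong₂ _+ℚ_ (ℚ.*-identityˡ (f zero)) (sym (*-distribˡ-sum 0ℚ (f ∘ suc))) ⟩
  f zero +ℚ 0ℚ *ℚ sum (f ∘ suc) ≡⟨ cong (f zero +ℚ_) (ℚ.*-zeroˡ (sum (f ∘ suc))) ⟩
  f zero +ℚ 0ℚ                  ≡⟨ ℚ.+-identityʳ (f zero) ⟩
  f zero                        ∎
  where open ≡-Reasoning
sum-Id-sift (suc i) f =
  trans (cong₂ _+ℚ_ (ℚ.*-zeroˡ (f zero)) (sum-Id-sift i (f ∘ suc))) (ℚ.+-identityˡ (f (suc i)))

sum-Id-col : ∀ {n} (j : Fin n) → sum (λ l → Id l j) ≡ 1ℚ
sum-Id-col j =
  trans (sum-cong-≗ (λ l → trans (Id-sym l j) (sym (ℚ.*-identityʳ (Id j l))))) (sum-Id-sift j (λ _ → 1ℚ))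

sum-Id-rotate : ∀ {d} b (j : Fin (suc d)) → sum (λ l → Id (rotate b l) j) ≡ 1ℚ
sum-Id-rotate {d} b j = trans (sum-cong-≗ reindex) (sum-Id-col (rotate (b * d) j))
  where
  reindex : ∀ l → Id (rotate b l) j ≡ Id l (rotate (b * d) j)
  reindex l = trans (cong (Id (rotate b l)) (sym (rotate-rightInverse b j)))
                    (Id-reindex (rotate-injective b) l (rotate (b * d) j))

parity : ℕ → ℚ
parity zero    = 0ℚ
parity (suc k) = 1ℚ -ℚ parity k

parity-+ : ∀ m n → parity (m + n) ≡ parity m +ℚ parity n -ℚ (1ℚ +ℚ 1ℚ) *ℚ (parity m *ℚ parity n)
parity-+ zero    n = base (parity n)
  where
  base : ∀ q → q ≡ 0ℚ +ℚ q -ℚ (1ℚ +ℚ 1ℚ) *ℚ (0ℚ *ℚ q)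
  base = RingSolver.solve-∀ ℚ-ring
parity-+ (suc m) n = trans (cong (1ℚ -ℚ_) (parity-+ m n)) (step (parity m) (parity n))
  where
  step : ∀ p q → 1ℚ -ℚ (p +ℚ q -ℚ (1ℚ +ℚ 1ℚ) *ℚ (p *ℚ q))
               ≡ (1ℚ -ℚ p) +ℚ q -ℚ (1ℚ +ℚ 1ℚ) *ℚ ((1ℚ -ℚ p) *ℚ q)
  step = RingSolver.solve-∀ ℚ-ring

parity-suc-suc : ∀ k → parity (suc (suc k)) ≡ parity k
parity-suc-suc k = involution (parity k)
  where
  involution : ∀ p → 1ℚ -ℚ (1ℚ -ℚ p) ≡ p
  involution = RingSolver.solve-∀ ℚ-ring

parity-0-or-1 : ∀ k → parity k ≡ 0ℚ ⊎ parity k ≡ 1ℚ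
parity-0-or-1 zero    = inj₁ refl
parity-0-or-1 (suc k) = [ inj₂ ∘ cong (1ℚ -ℚ_) , inj₁ ∘ cong (1ℚ -ℚ_) ]′ (parity-0-or-1 k)

parity≡0⇒2∣ : ∀ k → parity k ≡ 0ℚ → 2 ∣ k
parity≡0⇒2∣ zero          _  = divides 0 refl
parity≡0⇒2∣ (suc (suc k)) eq = ∣m∣n⇒∣m+n ∣-refl (parity≡0⇒2∣ k (trans (sym (parity-suc-suc k)) eq))

2∣⇒parity≡0 : ∀ {k} → 2 ∣ k → parity k ≡ 0ℚ
2∣⇒parity≡0 (divides-refl zero)    = refl
2∣⇒parity≡0 (divides-refl (suc q)) = trans (parity-suc-suc (q * 2)) (2∣⇒parity≡0 (divides-refl q))

c : ℕ → ℚ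
c d = -[1+ 1 ] ℚ./ suc d

c-negative : ∀ d → Negative (c d)
c-negative d = ℚ.neg-pos {ℚ.normalize 2 (suc d)} (ℚ.normalize-pos 2 (suc d))

toℚᵘ-sum-const : ∀ k i n → toℚᵘ (sum {k} (λ _ → i ℚ./ suc n)) ≃ᵘ mkℚᵘ (+ k ℤ.* i) n
toℚᵘ-sum-const zero    i n = *≡* (solve (i ∷ []))
toℚᵘ-sum-const (suc k) i n = begin
  toℚᵘ (x +ℚ sum {k} (λ _ → x))
    ≈⟨ ℚ.toℚᵘ-homo-+ x (sum {k} (λ _ → x)) ⟩
  toℚᵘ x ℚᵘ.+ toℚᵘ (sum {k} (λ _ → x))
    ≈⟨ ℚᵘ.+-cong (ℚ.toℚᵘ-fromℚᵘ (mkℚᵘ i n)) (toℚᵘ-sum-const k i n) ⟩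
  mkℚᵘ i n ℚᵘ.+ mkℚᵘ (+ k ℤ.* i) n
    ≈⟨ *≡* (trans (add i (+ suc n) (+ k)) (cong (+ suc k ℤ.* i ℤ.*_) denominator)) ⟩
  mkℚᵘ (+ suc k ℤ.* i) n
    ∎
  where
  open ℚᵘ.≃-Reasoning
  x : ℚ
  x = i ℚ./ suc n
  denominator : + suc n ℤ.* + suc n ≡ + (suc n ℕ.* suc n)
  denominator = sym (ℤ.pos-* (suc n) (suc n))
  add : ∀ i n k → (i ℤ.* n ℤ.+ k ℤ.* i ℤ.* n) ℤ.* n ≡ (+ 1 ℤ.+ k) ℤ.* i ℤ.* (n ℤ.* n)
  add = solve-∀

sum-c : ∀ d → sum {suc d} (λ _ → c d) ≡ - (1ℚ +ℚ 1ℚ)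
sum-c d = ℚ.toℚᵘ-injective (ℚᵘ.≃-trans (toℚᵘ-sum-const (suc d) -[1+ 1 ] d) (*≡* (cancel (+ suc d))))
  where
  cancel : ∀ n → n ℤ.* -[1+ 1 ] ℤ.* + 1 ≡ -[1+ 1 ] ℤ.* n
  cancel = solve-∀

pCoeff-zero : ∀ e → pCoeff (suc e) zero ≡ 1ℚ +ℚ c (suc e)
pCoeff-zero e = ℚ.toℚᵘ-injective (begin
  toℚᵘ (+ e ℚ./ suc (suc e))
    ≈⟨ ℚ.toℚᵘ-fromℚᵘ (mkℚᵘ (+ e) (suc e)) ⟩
  mkℚᵘ (+ e) (suc e)
    ≈⟨ *≡* (trans (cong (+ e ℤ.*_) (ℤ.pos-* 1 (suc (suc e)))) (split (+ e))) ⟩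
  toℚᵘ 1ℚ ℚᵘ.+ mkℚᵘ -[1+ 1 ] (suc e)
    ≈⟨ ℚᵘ.+-congʳ (toℚᵘ 1ℚ) (ℚ.toℚᵘ-fromℚᵘ (mkℚᵘ -[1+ 1 ] (suc e))) ⟨
  toℚᵘ 1ℚ ℚᵘ.+ toℚᵘ (c (suc e))
    ≈⟨ ℚ.toℚᵘ-homo-+ 1ℚ (c (suc e)) ⟨
  toℚᵘ (1ℚ +ℚ c (suc e))
    ∎)
  where
  open ℚᵘ.≃-Reasoning
  split : ∀ x → x ℤ.* (+ 1 ℤ.* (+ 2 ℤ.+ x))
              ≡ (+ 1 ℤ.* (+ 2 ℤ.+ x) ℤ.+ -[1+ 1 ] ℤ.* + 1) ℤ.* (+ 2 ℤ.+ x)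
  split = solve-∀

pCoeff≡Id+c : ∀ e k → pCoeff (suc e) k ≡ Id k zero +ℚ c (suc e)
pCoeff≡Id+c e zero    = pCoeff-zero e
pCoeff≡Id+c e (suc k) = sym (ℚ.+-identityˡ (c (suc e)))

-- Closed form of the powers of V

powForm : ∀ d → ℕ → Mat (suc d)
powForm d k i j = Id (rotate k i) j +ℚ c d *ℚ parity k

powForm-colSum : ∀ d b (j : Fin (suc d)) →
                 sum (λ l → powForm d b l j) ≡ 1ℚ +ℚ - (1ℚ +ℚ 1ℚ) *ℚ parity b
powForm-colSum d b j = begin
  sum (λ l → Id (rotate b l) j +ℚ γ)
    ≡⟨ ∑-distrib-+ (λ l → Id (rotate b l) j) (λ _ → γ) ⟩
  sum (λ l → Id (rotate b l) j) +ℚ sum {suc d} (λ _ → γ)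
    ≡⟨ cong₂ _+ℚ_ (sum-Id-rotate b j) (sym (*-distribʳ-sum (parity b) (λ (_ : Fin (suc d)) → c d))) ⟩
  1ℚ +ℚ sum {suc d} (λ _ → c d) *ℚ parity b
    ≡⟨ cong (λ s → 1ℚ +ℚ s *ℚ parity b) (sum-c d) ⟩
  1ℚ +ℚ - (1ℚ +ℚ 1ℚ) *ℚ parity b
    ∎
  where
  open ≡-Reasoning
  γ : ℚ
  γ = c d *ℚ parity b

powForm-⊗ : ∀ d a b (i j : Fin (suc d)) →
            sum (λ l → powForm d a i l *ℚ powForm d b l j) ≡ powForm d (a + b) i j
powForm-⊗ d a b i j = begin
  sum (λ l → (Id x l +ℚ c d *ℚ p) *ℚ F l)
    ≡⟨ sum-cong-≗ (λ l → ℚ.*-distribʳ-+ (F l) (Id x l) (c d *ℚ p)) ⟩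
  sum (λ l → Id x l *ℚ F l +ℚ c d *ℚ p *ℚ F l)
    ≡⟨ ∑-distrib-+ (λ l → Id x l *ℚ F l) (λ l → c d *ℚ p *ℚ F l) ⟩
  sum (λ l → Id x l *ℚ F l) +ℚ sum (λ l → c d *ℚ p *ℚ F l)
    ≡⟨ cong₂ _+ℚ_ (sum-Id-sift x F) (sym (*-distribˡ-sum (c d *ℚ p) F)) ⟩
  Id (rotate b x) j +ℚ c d *ℚ q +ℚ c d *ℚ p *ℚ sum F
    ≡⟨ cong₂ (λ y s → Id y j +ℚ c d *ℚ q +ℚ c d *ℚ p *ℚ s)
             (sym (iterate-+ cyclicPred i a b)) (powForm-colSum d b j) ⟩
  Id (rotate (a + b) i) j +ℚ c d *ℚ q +ℚ c d *ℚ p *ℚ (1ℚ +ℚ - (1ℚ +ℚ 1ℚ) *ℚ q)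
    ≡⟨ collect (Id (rotate (a + b) i) j) (c d) p q ⟩
  Id (rotate (a + b) i) j +ℚ c d *ℚ (p +ℚ q -ℚ (1ℚ +ℚ 1ℚ) *ℚ (p *ℚ q))
    ≡⟨ cong (λ r → Id (rotate (a + b) i) j +ℚ c d *ℚ r) (parity-+ a b) ⟨
  powForm d (a + b) i j
    ∎
  where
  open ≡-Reasoning
  x : Fin (suc d)
  x = rotate a i
  p q : ℚ
  p = parity a
  q = parity b
  F : Fin (suc d) → ℚ
  F l = powForm d b l j
  collect : ∀ z γ p q → z +ℚ γ *ℚ q +ℚ γ *ℚ p *ℚ (1ℚ +ℚ - (1ℚ +ℚ 1ℚ) *ℚ q)
                       ≡ z +ℚ γ *ℚ (p +ℚ q -ℚ (1ℚ +ℚ 1ℚ) *ℚ (p *ℚ q))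
  collect = RingSolver.solve-∀ ℚ-ring

powForm≡Id : ∀ d m → suc d ∣ m → 2 ∣ m → ∀ i j → powForm d m i j ≡ Id i j
powForm≡Id d .(q * suc d) (divides-refl q) 2∣m i j = begin
  Id (rotate (q * suc d) i) j +ℚ c d *ℚ parity (q * suc d)
    ≡⟨ cong₂ (λ y r → Id y j +ℚ c d *ℚ r) (rotate-multiple q i) (2∣⇒parity≡0 2∣m) ⟩
  Id i j +ℚ c d *ℚ 0ℚ ≡⟨ cong (Id i j +ℚ_) (ℚ.*-zeroʳ (c d)) ⟩
  Id i j +ℚ 0ℚ        ≡⟨ ℚ.+-identityʳ (Id i j) ⟩
  Id i j              ∎
  where open ≡-Reasoning

powForm-00≡1⇒ : ∀ d m → powForm d m zero zero ≡ 1ℚ → suc d ∣ m × 2 ∣ m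
powForm-00≡1⇒ d m eq with parity-0-or-1 m
... | inj₁ even = rotate-zero≡zero⇒∣ m (Id≡1⇒≡ Id≡1) , parity≡0⇒2∣ m even
  where
  open ≡-Reasoning
  x : Fin (suc d)
  x = rotate m zero
  Id≡1 : Id x zero ≡ 1ℚ
  Id≡1 = begin
    Id x zero                    ≡⟨ ℚ.+-identityʳ (Id x zero) ⟨
    Id x zero +ℚ 0ℚ              ≡⟨ cong (Id x zero +ℚ_) (trans (cong (c d *ℚ_) even) (ℚ.*-zeroʳ (c d))) ⟨
    Id x zero +ℚ c d *ℚ parity m ≡⟨ eq ⟩
    1ℚ                           ∎
... | inj₂ odd  = contradiction eq (ℚ.<⇒≢ lt)
  where
  open ℚ.≤-Reasoning
  x : Fin (suc d)
  x = rotate m zero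
  lt : powForm d m zero zero ℚ.< 1ℚ
  lt = begin-strict
    Id x zero +ℚ c d *ℚ parity m ≡⟨ cong (λ r → Id x zero +ℚ c d *ℚ r) odd ⟩
    Id x zero +ℚ c d *ℚ 1ℚ       ≡⟨ cong (Id x zero +ℚ_) (ℚ.*-identityʳ (c d)) ⟩
    Id x zero +ℚ c d             <⟨ ℚ.+-mono-≤-< (Id≤1 x zero) (ℚ.negative⁻¹ (c d) {{c-negative d}}) ⟩
    1ℚ +ℚ 0ℚ                     ≡⟨ ℚ.+-identityʳ 1ℚ ⟩
    1ℚ                           ∎

nonsingular : ∀ {n} (A : Mat n) k → ((A ^ k) ⊗ A) ≋ (A ^ suc k) → (A ^ suc k) ≋ Id → Nonsingular A
nonsingular A k comm A^[1+k]≋Id = A ^ k , A^[1+k]≋Id , λ i j → trans (comm i j) (A^[1+k]≋Id i j)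

hasOrder : ∀ {n} {A : Mat n} {N} → 0 < N → (A ^ N) ≋ Id → (∀ m → (A ^ m) ≋ Id → N ∣ m) → HasOrder A N
hasOrder 0<N A^N≋Id minimal =
  0<N , A^N≋Id , λ m 0<m m<N A^m≋Id → ℕ.<⇒≱ m<N (∣⇒≤ {{ℕ.>-nonZero 0<m}} (minimal m A^m≋Id))

-- The circulant matrix of p, for d = e + 1

V : ∀ e → Mat (suc (suc e))
V e = circulant (pCoeff (suc e))

V≡powForm : ∀ e (i j : Fin (suc (suc e))) → V e i j ≡ powForm (suc e) 1 i j
V≡powForm e i j = begin
  V e i j                           ≡⟨ iterT-rotate (toℕ i) (pCoeff (suc e) ∘ opposite) j ⟩
  pCoeff (suc e) (opposite y)       ≡⟨ pCoeff≡Id+c e (opposite y) ⟩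
  Id (opposite y) zero +ℚ c (suc e) ≡⟨ cong₂ _+ℚ_ entry (ℚ.*-identityʳ (c (suc e))) ⟨
  powForm (suc e) 1 i j             ∎
  where
  open ≡-Reasoning
  t : ℕ
  t = toℕ i
  y : Fin (suc (suc e))
  y = rotate t j
  entry : Id (cyclicPred i) j ≡ Id (opposite y) zero
  entry = begin
    Id (cyclicPred i) j
      ≡⟨ Id-sym (cyclicPred i) j ⟩
    Id j (cyclicPred i)
      ≡⟨ Id-reindex (rotate-injective t) j (cyclicPred i) ⟨
    Id y (rotate t (cyclicPred i))
      ≡⟨ cong (Id y) (trans (iterate-suc cyclicPred i t) (cong cyclicPred (rotate-toℕ i))) ⟩
    Id y (fromℕ (suc e))
      ≡⟨ Id-reindex opposite-injective y (fromℕ (suc e)) ⟨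
    Id (opposite y) (opposite (fromℕ (suc e)))
      ≡⟨ cong (Id (opposite y)) (opposite-involutive zero) ⟩
    Id (opposite y) zero
      ∎

V^≡powForm : ∀ e k (i j : Fin (suc (suc e))) → (V e ^ k) i j ≡ powForm (suc e) k i j
V^≡powForm e zero    i j = sym (trans (cong (Id i j +ℚ_) (ℚ.*-zeroʳ (c (suc e)))) (ℚ.+-identityʳ (Id i j)))
V^≡powForm e (suc k) i j = begin
  (V e ⊗ (V e ^ k)) i j
    ≡⟨ ∑≡sum (λ l → V e i l *ℚ (V e ^ k) l j) ⟩
  sum (λ l → V e i l *ℚ (V e ^ k) l j)
    ≡⟨ sum-cong-≗ (λ l → cong₂ _*ℚ_ (V≡powForm e i l) (V^≡powForm e k l j)) ⟩
  sum (λ l → powForm (suc e) 1 i l *ℚ powForm (suc e) k l j)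
    ≡⟨ powForm-⊗ (suc e) 1 k i j ⟩
  powForm (suc e) (suc k) i j
    ∎
  where open ≡-Reasoning

V^⊗V : ∀ e k → ((V e ^ k) ⊗ V e) ≋ (V e ^ suc k)
V^⊗V e k i j = begin
  ((V e ^ k) ⊗ V e) i j
    ≡⟨ ∑≡sum (λ l → (V e ^ k) i l *ℚ V e l j) ⟩
  sum (λ l → (V e ^ k) i l *ℚ V e l j)
    ≡⟨ sum-cong-≗ (λ l → cong₂ _*ℚ_ (V^≡powForm e k i l) (V≡powForm e l j)) ⟩
  sum (λ l → powForm (suc e) k i l *ℚ powForm (suc e) 1 l j)
    ≡⟨ powForm-⊗ (suc e) k 1 i j ⟩
  powForm (suc e) (k + 1) i j
    ≡⟨ cong (λ m → powForm (suc e) m i j) (ℕ.+-comm k 1) ⟩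
  powForm (suc e) (suc k) i j
    ≡⟨ V^≡powForm e (suc k) i j ⟨
  (V e ^ suc k) i j
    ∎
  where open ≡-Reasoning

V^≋Id⇒ : ∀ e m → (V e ^ m) ≋ Id → suc (suc e) ∣ m × 2 ∣ m
V^≋Id⇒ e m V^m≋Id = powForm-00≡1⇒ (suc e) m (trans (sym (V^≡powForm e m zero zero)) (V^m≋Id zero zero))

∣⇒V^≋Id : ∀ e m → suc (suc e) ∣ m → 2 ∣ m → (V e ^ m) ≋ Id
∣⇒V^≋Id e m n∣m 2∣m i j = trans (V^≡powForm e m i j) (powForm≡Id (suc e) m n∣m 2∣m i j)

theorem16 : (d : ℕ) → 2 ≤ d →
    Nonsingular (circulant (pCoeff d))
    × (¬ (2 ∣ d) → HasOrder (circulant (pCoeff d)) (suc d))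
    × (2 ∣ d → HasOrder (circulant (pCoeff d)) (2 * suc d))
theorem16 zero    ()
theorem16 (suc e) _  = nonsingular (V e) 2n-1 (V^⊗V e 2n-1) V^2n≋Id , oddOrder , evenOrder
  where
  d n 2n-1 : ℕ
  d = suc e
  n = suc d
  2n-1 = ℕ.pred (2 * n)

  V^2n≋Id : (V e ^ (2 * n)) ≋ Id
  V^2n≋Id = ∣⇒V^≋Id e (2 * n) (n∣m*n 2) (m∣m*n n)

  oddOrder : ¬ 2 ∣ d → HasOrder (V e) n
  oddOrder d-odd =
    hasOrder z<s (∣⇒V^≋Id e n ∣-refl (¬2∣⇒2∣suc d-odd)) (λ m → proj₁ ∘ V^≋Id⇒ e m)

  evenOrder : 2 ∣ d → HasOrder (V e) (2 * n)
  evenOrder d-even =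
    hasOrder z<s V^2n≋Id (λ m → uncurry (∣∧2∣⇒2*∣ (2∣⇒¬2∣suc d-even)) ∘ V^≋Id⇒ e m)
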